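{- Let $G$ be a finite simple graph that is $d$-distinguishable. Then $\det(G)\le \rho^d(G)$. Moreover, equality can be achieved: there exists an integer $d'$ such that $G$ is $d'$-distinguishable and $\rho^{d'}(G)=\det(G)$.
   Context: A $d$-distinguishing coloring of $G$ is an assignment of colors from a set of $d$ colors to the vertices such that the only automorphism of $G$ mapping each color class to itself is the identity; $G$ is $d$-distinguishable if such a coloring exists. The paint cost of $d$-distinguishing, $\rho^d(G)$, is the minimum of $|V(G)\setminus T|$ over all $d$-distinguishing colorings of $G$ and all color classes $T$ of such a coloring. A determining set for $G$ is a set $S\subseteq V(G)$ such that the only automorphism fixing every vertex of $S$ is the identity; $\det(G)$ is the minimum size of a determining set. -}

module Defs where

open import Data.Nat using (ℕ; _≤_)
open import Data.Bool using (Bool; true; false)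
open import Data.Fin using (Fin; _≟_)
open import Data.Fin.Subset using (Subset; _∈_; ∁; ∣_∣)
open import Data.Fin.Permutation using (Permutation′; _⟨$⟩ʳ_)
open import Data.Vec using (tabulate)
open import Data.Product using (Σ; ∃; _×_)
open import Relation.Nullary.Decidable using (isYes)
open import Relation.Binary.PropositionalEquality using (_≡_)

record Graph (n : ℕ) : Set where
  field
    adj   : Fin n → Fin n → Bool
    sym   : ∀ u v → adj u v ≡ adj v u
    irrefl : ∀ v → adj v v ≡ false
open Graph public

IsAut : ∀ {n} → Graph n → Permutation′ n → Set
IsAut G σ = ∀ u v → adj G (σ ⟨$⟩ʳ u) (σ ⟨$⟩ʳ v) ≡ adj G u v

IsIdentity : ∀ {n} → Permutation′ n → Set
IsIdentity σ = ∀ v → σ ⟨$⟩ʳ v ≡ v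

Coloring : ℕ → ℕ → Set
Coloring n d = Fin n → Fin d

PreservesColors : ∀ {n d} → Coloring n d → Permutation′ n → Set
PreservesColors c σ = ∀ v → c (σ ⟨$⟩ʳ v) ≡ c v

IsDistinguishing : ∀ {n d} → Graph n → Coloring n d → Set
IsDistinguishing G c = ∀ σ → IsAut G σ → PreservesColors c σ → IsIdentity σ

Distinguishable : ∀ {n} → ℕ → Graph n → Set
Distinguishable d G = Σ (Coloring _ d) (IsDistinguishing G)

colorClass : ∀ {n d} → Coloring n d → Fin d → Subset n
colorClass c i = tabulate (λ v → isYes (c v ≟ i))

paint : ∀ {n d} → Coloring n d → Fin d → ℕ
paint c i = ∣ ∁ (colorClass c i) ∣

IsPaintCost : ∀ {n} → ℕ → Graph n → ℕ → Set
IsPaintCost {n} d G r =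
  (Σ (Coloring n d) λ c → IsDistinguishing G c × ∃ λ i → paint c i ≡ r)
  × (∀ (c : Coloring n d) → IsDistinguishing G c → ∀ i → r ≤ paint c i)

IsDetermining : ∀ {n} → Graph n → Subset n → Set
IsDetermining G S = ∀ σ → IsAut G σ → (∀ v → v ∈ S → σ ⟨$⟩ʳ v ≡ v) → IsIdentity σ

IsDet : ∀ {n} → Graph n → ℕ → Set
IsDet G k = (∃ λ S → IsDetermining G S × ∣ S ∣ ≡ k)
          × (∀ S → IsDetermining G S → k ≤ ∣ S ∣)

{-# OPTIONS --safe #-}
module Submission where

-- If c is d-distinguishing and T is one of its colour classes, then V ∖ T is determining:
-- an automorphism σ fixing V ∖ T pointwise maps T into T (were σ v ∉ T, then σ v would be
-- fixed, so σ v = v by injectivity), hence preserves c and is the identity.  So det G ≤ ρᵈ(G).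
-- Conversely, giving each vertex of a minimum determining set S its own colour and all other
-- vertices one common colour is distinguishing, and the complement of the common class is S;
-- with n + 1 colours the paint cost is therefore exactly det G.

open import Defs hiding (sym)
open import Level using (Level)
open import Data.Nat using (ℕ; suc; _≤_; _<_; _<?_)
open import Data.Nat.Properties using (≮⇒≥)
open import Data.Nat.Induction using (<-wellFounded)
open import Data.Product using (∃; _×_; _,_; proj₁; map₂)
import Data.Bool as Bool
open import Data.Fin using (Fin; zero; suc; _≟_)
open import Data.Fin.Properties using (all?; suc-injective)
open import Data.Fin.Subset using (Subset; _∈_; ∁; ∣_∣; ⊤)
open import Data.Fin.Subset.Properties
  using (_∈?_; anySubset?; ∈⊤; ⊆-antisym; x∉p⇒x∈∁p; x∈∁p⇒x∉p)
open import Data.Fin.Permutation using (Permutation′; _⟨$⟩ʳ_; _⟨$⟩ˡ_; inverseˡ; inverseʳ; permutation)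
open import Data.Vec.Functional using (_∷_; head; tail)
open import Data.Vec.Properties using (lookup∘tabulate; []=⇒lookup; lookup⇒[]=)
open import Function using (_∘_)
open import Function.Definitions using (StrictlyInverseˡ; StrictlyInverseʳ)
open import Induction.WellFounded using (Acc; acc)
open import Relation.Nullary using (Dec; yes; no; contradiction)
open import Relation.Nullary.Decidable using (isYes; isYes≗does; map′; dec-true; _×-dec_; _→-dec_)
open import Relation.Unary using (Pred; Decidable)
open import Relation.Binary.PropositionalEquality
  using (_≡_; _≢_; _≗_; refl; sym; trans; cong; cong₂; subst; module ≡-Reasoning)

private
  variable
    ℓ : Level
    n d : ℕ

module _ {P : Pred (Subset n) ℓ} (P? : Decidable P) where

  smallest : ∀ S → P S → ∃ λ T → P T × (∀ U → P U → ∣ T ∣ ≤ ∣ U ∣)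
  smallest S = go S (<-wellFounded ∣ S ∣)
    where
    go : ∀ S → Acc _<_ ∣ S ∣ → P S → ∃ λ T → P T × (∀ U → P U → ∣ T ∣ ≤ ∣ U ∣)
    go S (acc rs) pS with anySubset? (λ T → P? T ×-dec ∣ T ∣ <? ∣ S ∣)
    ... | yes (T , pT , T<S) = go T (rs T<S) pT
    ... | no ∄smaller = S , pS , λ U pU → ≮⇒≥ λ U<S → ∄smaller (U , pU , U<S)

all-functions? : ∀ k {m} {P : (Fin k → Fin m) → Set ℓ} → (∀ f → Dec (P f)) →
                 (∀ {f g} → f ≗ g → P f → P g) → Dec (∀ f → P f)
all-functions? 0 P? resp = map′ (λ p f → resp (λ ()) p) (λ h → h _) (P? λ ())
all-functions? (suc k) {P = P} P? resp =
  map′ (λ h f → resp (head-tail f) (h (head f) (tail f))) (λ h a g → h (a ∷ g))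
       (all? λ a → all-functions? k (λ g → P? (a ∷ g)) (λ g≗g′ → resp (cons-cong a g≗g′)))
  where
  head-tail : ∀ f → (head f ∷ tail f) ≗ f
  head-tail f zero    = refl
  head-tail f (suc i) = refl

  cons-cong : ∀ a {g g′ : Fin k → _} → g ≗ g′ → (a ∷ g) ≗ (a ∷ g′)
  cons-cong a g≗g′ zero    = refl
  cons-cong a g≗g′ (suc i) = g≗g′ i

module _ {P : (Fin n → Fin n) → Set ℓ} (P? : ∀ f → Dec (P f))
         (resp : ∀ {f g} → f ≗ g → P f → P g) where

  private
    Inverses : (Fin n → Fin n) → (Fin n → Fin n) → Set
    Inverses f g = StrictlyInverseˡ _≡_ f g × StrictlyInverseʳ _≡_ f g

    inverses? : ∀ f g → Dec (Inverses f g)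
    inverses? f g = all? (λ i → f (g i) ≟ i) ×-dec all? (λ i → g (f i) ≟ i)

    inverses-cong : ∀ {f f′ g g′} → f ≗ f′ → g ≗ g′ → Inverses f g → Inverses f′ g′
    inverses-cong {f} {f′} {g} {g′} f≗f′ g≗g′ (fg , gf) =
      (λ i → trans (sym (trans (f≗f′ (g i)) (cong f′ (g≗g′ i)))) (fg i)) ,
      (λ i → trans (sym (trans (g≗g′ (f i)) (cong g′ (f≗f′ i)))) (gf i))

    ∀-inverse? : ∀ f → Dec (∀ g → Inverses f g → P f)
    ∀-inverse? f = all-functions? n (λ g → inverses? f g →-dec P? f)
      (λ g≗g′ h → h ∘ inverses-cong (λ _ → refl) (sym ∘ g≗g′))

    ∀-inverse-cong : ∀ {f f′} → f ≗ f′ → (∀ g → Inverses f g → P f) → (∀ g → Inverses f′ g → P f′)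
    ∀-inverse-cong f≗f′ h g = resp f≗f′ ∘ h g ∘ inverses-cong (sym ∘ f≗f′) (λ _ → refl)

  -- A permutation is a pair of mutually inverse maps, and maps can be enumerated.
  all-permutations? : Dec (∀ (σ : Permutation′ n) → P (σ ⟨$⟩ʳ_))
  all-permutations? =
    map′ (λ h σ → h (σ ⟨$⟩ʳ_) (σ ⟨$⟩ˡ_) ((λ _ → inverseʳ σ) , (λ _ → inverseˡ σ)))
         (λ h f g (fg , gf) → h (permutation f g fg gf))
         (all-functions? n ∀-inverse? ∀-inverse-cong)

determining? : (G : Graph n) (S : Subset n) → Dec (IsDetermining G S)
determining? {n} G S = all-permutations? forces-identity? forces-identity-cong
  where
  ForcesIdentity : (Fin n → Fin n) → Set
  ForcesIdentity f = (∀ u v → adj G (f u) (f v) ≡ adj G u v) →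
                     (∀ v → v ∈ S → f v ≡ v) → ∀ v → f v ≡ v

  forces-identity? : ∀ f → Dec (ForcesIdentity f)
  forces-identity? f =
    all? (λ u → all? λ v → adj G (f u) (f v) Bool.≟ adj G u v) →-dec
    all? (λ v → v ∈? S →-dec f v ≟ v) →-dec
    all? (λ v → f v ≟ v)

  forces-identity-cong : ∀ {f g} → f ≗ g → ForcesIdentity f → ForcesIdentity g
  forces-identity-cong f≗g h aut fix v = trans (sym (f≗g v)) (h
    (λ u w → trans (cong₂ (adj G) (f≗g u) (f≗g w)) (aut u w))
    (λ w w∈S → trans (f≗g w) (fix w w∈S)) v)

det-exists : (G : Graph n) → ∃ (IsDet G)
det-exists G with smallest (determining? G) ⊤ (λ σ aut fix v → fix v ∈⊤)
... | S , S-det , S-smallest = ∣ S ∣ , (S , S-det , refl) , S-smallest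

module _ {c : Coloring n d} {i : Fin d} {v : Fin n} where

  ∈-colorClass⁺ : c v ≡ i → v ∈ colorClass c i
  ∈-colorClass⁺ cv≡i = lookup⇒[]= v _
    (trans (lookup∘tabulate _ v) (trans (isYes≗does (c v ≟ i)) (dec-true (c v ≟ i) cv≡i)))

  ∈-colorClass⁻ : v ∈ colorClass c i → c v ≡ i
  ∈-colorClass⁻ v∈ = witness (c v ≟ i) (trans (sym (lookup∘tabulate _ v)) ([]=⇒lookup v∈))
    where
    witness : (cv≟i : Dec (c v ≡ i)) → isYes cv≟i ≡ Bool.true → c v ≡ i
    witness (yes cv≡i) _ = cv≡i
    witness (no _)     ()

  ∈-∁colorClass⁺ : c v ≢ i → v ∈ ∁ (colorClass c i)
  ∈-∁colorClass⁺ cv≢i = x∉p⇒x∈∁p (cv≢i ∘ ∈-colorClass⁻)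

  ∈-∁colorClass⁻ : v ∈ ∁ (colorClass c i) → c v ≢ i
  ∈-∁colorClass⁻ v∈ cv≡i = x∈∁p⇒x∉p v∈ (∈-colorClass⁺ cv≡i)

⟨$⟩ʳ-injective : (σ : Permutation′ n) {u v : Fin n} → σ ⟨$⟩ʳ u ≡ σ ⟨$⟩ʳ v → u ≡ v
⟨$⟩ʳ-injective σ {u} {v} eq = begin
  u                       ≡⟨ inverseˡ σ ⟨
  σ ⟨$⟩ˡ (σ ⟨$⟩ʳ u)       ≡⟨ cong (σ ⟨$⟩ˡ_) eq ⟩
  σ ⟨$⟩ˡ (σ ⟨$⟩ʳ v)       ≡⟨ inverseˡ σ ⟩
  v                       ∎
  where open ≡-Reasoning

∁colorClass-determining : (G : Graph n) {c : Coloring n d} → IsDistinguishing G c →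
                          ∀ i → IsDetermining G (∁ (colorClass c i))
∁colorClass-determining G {c} distinguishing i σ aut fix = distinguishing σ aut preserves
  where
  preserves : PreservesColors c σ
  preserves v with c v ≟ i | c (σ ⟨$⟩ʳ v) ≟ i
  ... | no cv≢i | _           = cong c (fix v (∈-∁colorClass⁺ cv≢i))
  ... | yes cv≡i | yes cσv≡i  = trans cσv≡i (sym cv≡i)
  ... | yes cv≡i | no cσv≢i   = contradiction (trans (cong c σv≡v) cv≡i) cσv≢i
    where
    σv≡v : σ ⟨$⟩ʳ v ≡ v
    σv≡v = ⟨$⟩ʳ-injective σ (fix (σ ⟨$⟩ʳ v) (∈-∁colorClass⁺ cσv≢i))

det≤paint : (G : Graph n) {k : ℕ} → IsDet G k →
            ∀ {c : Coloring n d} → IsDistinguishing G c → ∀ i → k ≤ paint c i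
det≤paint G (_ , minimal) distinguishing i =
  minimal _ (∁colorClass-determining G distinguishing i)

separating : Subset n → Coloring n (suc n)
separating S v with v ∈? S
... | yes _ = suc v
... | no  _ = zero

module _ {S : Subset n} where

  separating-∈ : ∀ {v} → v ∈ S → separating S v ≡ suc v
  separating-∈ {v} v∈S with v ∈? S
  ... | yes _   = refl
  ... | no v∉S = contradiction v∈S v∉S

  separating-suc⁻¹ : ∀ {u v} → separating S u ≡ suc v → u ≡ v
  separating-suc⁻¹ {u} with u ∈? S
  ... | yes _ = suc-injective
  ... | no  _ = λ ()

  separating-≢zero⁻¹ : ∀ {v} → separating S v ≢ zero → v ∈ S
  separating-≢zero⁻¹ {v} with v ∈? S
  ... | yes v∈S = λ _ → v∈S
  ... | no  _   = λ ≢zero → contradiction refl ≢zero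

  separating-distinguishing : (G : Graph n) → IsDetermining G S → IsDistinguishing G (separating S)
  separating-distinguishing G determining σ aut preserves =
    determining σ aut λ v v∈S → separating-suc⁻¹ (trans (preserves v) (separating-∈ v∈S))

  ∁colorClass-separating : ∁ (colorClass (separating S) zero) ≡ S
  ∁colorClass-separating = ⊆-antisym
    (separating-≢zero⁻¹ ∘ ∈-∁colorClass⁻)
    (λ v∈S → ∈-∁colorClass⁺ (λ eq → contradiction (trans (sym (separating-∈ v∈S)) eq) λ ()))

  paint-separating : paint (separating S) zero ≡ ∣ S ∣
  paint-separating = cong ∣_∣ ∁colorClass-separating

det≤paintCost : (G : Graph n) {k r : ℕ} → IsDet G k → IsPaintCost d G r → k ≤ r
det≤paintCost G {k} det-k ((_ , distinguishing , i , paint≡r) , _) =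
  subst (k ≤_) paint≡r (det≤paint G det-k distinguishing i)

paintCost-separating : (G : Graph n) {k : ℕ} → IsDet G k → IsPaintCost (suc n) G k
paintCost-separating G det-k@((S , S-determining , ∣S∣≡k) , _) =
  ( separating S , separating-distinguishing G S-determining
  , zero , trans (paint-separating {S = S}) ∣S∣≡k )
  , λ _ distinguishing → det≤paint G det-k distinguishing

mainTheorem2 : ∀ {n} (G : Graph n) (d : ℕ) → Distinguishable d G →
    (∀ k r → IsDet G k → IsPaintCost d G r → k ≤ r)
    × (∃ λ d′ → Distinguishable d′ G × ∃ λ k → IsDet G k × IsPaintCost d′ G k)
mainTheorem2 {n} G d _ with det-exists G
... | k , det-k =
  (λ _ _ → det≤paintCost G) ,
  (suc n , map₂ proj₁ (proj₁ paintCost) , k , det-k , paintCost)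
  where
  paintCost : IsPaintCost (suc n) G k
  paintCost = paintCost-separating G det-k
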